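{- Let $\mathfrak{b}=(\gamma,\alpha,\sigma)$ be a planted bicellular map of genus $g$. Then $\mathfrak{b}$ has exactly $2(g+1)$ trisections.
   Context: A map on a finite set $H$ of $2N$ half-edges is a triple $(\gamma,\alpha,\sigma)$ of permutations of $H$ such that $\alpha$ is a fixed-point-free involution and $\gamma=\alpha\circ\sigma$, i.e. $\gamma(h)=\alpha(\sigma(h))$. The cycles of $\sigma$, $\alpha$, $\gamma$ are called vertices, edges and faces; $|\pi|$ denotes the number of cycles of a permutation $\pi$. A map is connected if the group generated by $\alpha$ and $\sigma$ acts transitively on $H$, and the genus $g$ of a connected map is defined by $|\sigma|+|\gamma|=|\alpha|+2-2g$. A planted bicellular map with $n$ (non-plant) edges is a map on $H=\{1,\dots,2n\}\cup\{p_1,p_2,p_3,p_4\}$ with $\gamma=(p_1,1,2,\dots,m,p_2)(p_3,m+1,\dots,2n,p_4)$ for some $0\le m\le 2n$, where $\alpha$ contains the transpositions $(p_1\,p_2)$ and $(p_3\,p_4)$ (the plants), and there is a half-edge $x$ in the first face with $\alpha(x)$ in the second face (so the map is connected). Its genus is computed with all $n+2$ edges and the $2$ faces. Define the total order $<_\gamma$ on $H$ by $p_1<_\gamma 1<_\gamma 2<_\gamma\cdots<_\gamma m<_\gamma p_2<_\gamma p_3<_\gamma m+1<_\gamma\cdots<_\gamma 2n<_\gamma p_4$. The minimum of a vertex is its $<_\gamma$-smallest half-edge. A half-edge $h$ is an up-step if $h<_\gamma\sigma(h)$ and a down-step if $\sigma(h)\le_\gamma h$. A half-edge $h$ is a trisection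 if $h$ is a down-step and $\sigma(h)$ is not the minimum of the vertex containing $h$. -}

module Defs where

open import Data.Nat using (ℕ; zero; suc; _+_; _*_; _≤_; _<_; _≤ᵇ_; s≤s)
open import Data.Nat.Properties using (_≟_; m≤n⇒m≤1+n)
open import Data.Fin using (Fin; zero; suc; toℕ; fromℕ<; lower₁)
open import Data.Bool using (Bool; true; false; not; _∧_)
open import Data.List using (List; length; filterᵇ; upTo; allFin; map)
open import Data.Bool.ListAction using (and)
open import Data.Product using (Σ; _×_; ∃)
open import Relation.Nullary using (¬_; yes; no)
open import Relation.Binary.PropositionalEquality using (_≡_; _≢_; sym)

-- Half-edges are encoded by their position in the total order <_γ :
--   p₁ ↦ 0, 1..m ↦ 1..m, p₂ ↦ m+1, p₃ ↦ m+2, m+1..2n ↦ m+3..2n+2, p₄ ↦ 2n+3.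
-- Hence H = Fin (4 + 2n) and <_γ is the usual order on Fin (via toℕ).
HE : ℕ → Set
HE n = Fin (4 + 2 * n)

-- The face permutation γ = (p₁,1,…,m,p₂)(p₃,m+1,…,2n,p₄) in this encoding.
γ : (n m : ℕ) → m ≤ 2 * n → HE n → HE n
γ n m m≤ i with toℕ i ≟ suc m
... | yes _ = zero
... | no _ with toℕ i ≟ 3 + 2 * n
...   | yes _ = fromℕ< {suc (suc m)} (s≤s (s≤s (s≤s (m≤n⇒m≤1+n m≤))))
...   | no ne = suc (lower₁ i (λ e → ne (sym e)))

iter : {A : Set} → (A → A) → ℕ → A → A
iter f zero x = x
iter f (suc k) x = f (iter f k x)

-- h is the minimum (w.r.t. the order on Fin N) of its cycle under the
-- permutation f (the cycle of h is {f^k h | k < N}).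
isMin : {N : ℕ} → (Fin N → Fin N) → Fin N → Bool
isMin {N} f h = and (map (λ k → toℕ h ≤ᵇ toℕ (iter f k h)) (upTo N))

numCycles : {N : ℕ} → (Fin N → Fin N) → ℕ
numCycles {N} f = length (filterᵇ (isMin f) (allFin N))

-- Planted bicellular map with n non-plant edges.
record PlantedBicellular (n : ℕ) : Set where
  field
    m       : ℕ
    m≤2n    : m ≤ 2 * n
    α       : HE n → HE n
    α-invol : ∀ h → α (α h) ≡ h
    α-fpf   : ∀ h → α h ≢ h
    -- plant (p₁ p₂): α p₁ = p₂
    plant₁  : toℕ (α zero) ≡ suc m
    -- plant (p₃ p₄): α p₃ = p₄
    plant₂  : ∀ h → toℕ h ≡ suc (suc m) → toℕ (α h) ≡ 3 + 2 * n
    -- connectivity: some x in the first face with α x in the second face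
    connected : ∃ λ (x : HE n) → (toℕ x ≤ suc m) × (suc m < toℕ (α x))

  γ′ : HE n → HE n
  γ′ = γ n m m≤2n

  -- γ = α ∘ σ with α an involution, hence σ = α ∘ γ
  σ : HE n → HE n
  σ h = α (γ′ h)

  downStep : HE n → Bool
  downStep h = toℕ (σ h) ≤ᵇ toℕ h

  -- trisection: down-step and σ(h) is not the minimum of its vertex
  -- (the vertex containing h is the σ-cycle of h, which contains σ h)
  trisection : HE n → Bool
  trisection h = downStep h ∧ not (isMin σ (σ h))

  numTrisections : ℕ
  numTrisections = length (filterᵇ trisection (allFin (4 + 2 * n)))

  numVertices : ℕ
  numVertices = numCycles σ

-- Count the down-steps in two ways. Every vertex minimum is σ h for a unique down-step h
-- (the σ-predecessor of a minimum lies above it), and by definition the remaining down-steps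
-- are the trisections, so #down-steps = #vertices + #trisections. On the other hand
-- σ = α ∘ γ, and γ is the successor map of the order <_γ except at the two plant roots
-- p₁ and p₃; so h is a down-step iff x = γ h satisfies α x <_γ x, or x is a plant root.
-- As α is a fixed-point-free involution, exactly half of the 2n + 4 half-edges satisfy
-- α x <_γ x, hence #down-steps = n + 4, and
-- the genus formula |σ| = n + 2 - 2g gives #trisections = 2g + 2.
module Submission where

open import Defs
open import Data.Bool using (Bool; true; false; not; _∧_; _∨_; T; if_then_else_)
open import Data.Bool.Properties using (T-≡; T-∨; ∧-identityʳ)
open import Data.Empty using (⊥-elim)
open import Data.Fin using (Fin; zero; suc; toℕ)
open import Data.Fin.Permutation using (Permutation′; permutation; _⟨$⟩ʳ_)
open import Data.Fin.Properties using (pigeonhole; toℕ<n; toℕ-injective; toℕ-fromℕ<; toℕ-lower₁)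
open import Data.Integer using (ℤ; +_; _-_; _*_)
import Data.Integer as ℤ
open import Data.Integer.Properties using (pos-+)
open import Data.Integer.Tactic.RingSolver using (solve-∀)
open import Data.List using (length; filterᵇ; tabulate; upTo)
open import Data.List.Relation.Unary.All.Properties using (all⁺; applyUpTo⁻)
open import Data.Nat as ℕ using (ℕ; zero; suc; _+_; _≤_; _<_; _≤ᵇ_; _<ᵇ_; _≡ᵇ_; s≤s; s≤s⁻¹)
open import Data.Nat.Properties
open import Data.Product using (∃; _×_; _,_; proj₁; proj₂)
open import Data.Sum using (inj₁; inj₂)
open import Function using (id; _∘_; mk⇔; Equivalence)
open import Function.Definitions using (Injective)
open import Relation.Binary.Definitions using (tri<; tri≈; tri>)
open import Relation.Binary.PropositionalEquality
open import Relation.Nullary using (¬_; does; yes; no)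
open import Relation.Nullary.Decidable using (dec-true; dec-false; does-⇔)
open import Algebra.Properties.CommutativeMonoid.Sum +-0-commutativeMonoid
  using (sum; sum-cong-≗; ∑-distrib-+; sum-permute)

indicator : Bool → ℕ
indicator b = if b then 1 else 0

count : {N : ℕ} → (Fin N → Bool) → ℕ
count p = sum (indicator ∘ p)

module _ {N : ℕ} where

  count-cong : {p q : Fin N → Bool} → (∀ i → p i ≡ q i) → count p ≡ count q
  count-cong p≗q = sum-cong-≗ (cong indicator ∘ p≗q)

  count-permute : (p : Fin N → Bool) (π : Permutation′ N) → count (p ∘ (π ⟨$⟩ʳ_)) ≡ count p
  count-permute p π = sym (sum-permute (indicator ∘ p) π)

  count-all : {p : Fin N → Bool} → (∀ i → T (p i)) → count p ≡ N
  count-all {p} all-p = trans (count-cong (λ i → Equivalence.to T-≡ (all-p i))) (count-true N)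
    where
    count-true : ∀ N → count {N} (λ _ → true) ≡ N
    count-true zero    = refl
    count-true (suc N) = cong suc (count-true N)

  count-∨-disjoint : (p q : Fin N → Bool) → (∀ i → T (p i) → ¬ T (q i)) →
                     count (λ i → p i ∨ q i) ≡ count p + count q
  count-∨-disjoint p q disjoint =
    trans (sum-cong-≗ (λ i → indicator-∨ (p i) (q i) (disjoint i)))
          (∑-distrib-+ (indicator ∘ p) (indicator ∘ q))
    where
    indicator-∨ : ∀ a b → (T a → ¬ T b) → indicator (a ∨ b) ≡ indicator a + indicator b
    indicator-∨ true  true  a⇒¬b = ⊥-elim (a⇒¬b _ _)
    indicator-∨ true  false _    = refl
    indicator-∨ false b     _    = refl

  count-⊆ : (p q : Fin N → Bool) → (∀ i → T (q i) → T (p i)) →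
            count p ≡ count q + count (λ i → p i ∧ not (q i))
  count-⊆ p q q⊆p =
    trans (count-cong (λ i → split (p i) (q i) (q⊆p i)))
          (count-∨-disjoint q _ (λ i → disjoint (p i) (q i)))
    where
    split : ∀ a b → (T b → T a) → a ≡ b ∨ (a ∧ not b)
    split true  true  _   = refl
    split false true  b⇒a = ⊥-elim (b⇒a _)
    split a     false _   = sym (∧-identityʳ a)

    disjoint : ∀ a b → T b → ¬ T (a ∧ not b)
    disjoint true  true _ ()
    disjoint false true _ ()

  count-singleton : ∀ k → k < N → count (λ (i : Fin N) → toℕ i ≡ᵇ k) ≡ 1
  count-singleton k k<N = go N k k<N
    where
    none : ∀ N → count (λ (i : Fin N) → false) ≡ 0
    none zero    = refl
    none (suc N) = none N

    go : ∀ N k → k < N → count (λ (i : Fin N) → toℕ i ≡ᵇ k) ≡ 1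
    go (suc N) zero    _         = cong suc (none N)
    go (suc N) (suc k) (s≤s k<N) = go N k k<N

both-true : {a b : Bool} → T a → T b → a ≡ b
both-true {true} {true} _ _ = refl

length-filterᵇ-tabulate : {A : Set} (p : A → Bool) {N : ℕ} (f : Fin N → A) →
                          length (filterᵇ p (tabulate f)) ≡ count (p ∘ f)
length-filterᵇ-tabulate p {zero}  f = refl
length-filterᵇ-tabulate p {suc N} f with p (f zero)
... | true  = cong suc (length-filterᵇ-tabulate p (f ∘ suc))
... | false = length-filterᵇ-tabulate p (f ∘ suc)

iter-suc : {A : Set} (f : A → A) (k : ℕ) (x : A) → iter f k (f x) ≡ iter f (suc k) x
iter-suc f zero    x = refl
iter-suc f (suc k) x = cong f (iter-suc f k x)

module _ {N : ℕ} {f : Fin N → Fin N} (f-injective : Injective _≡_ _≡_ f) where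

  iter-period : ∀ x a b → a < b → iter f a x ≡ iter f b x → ∃ λ k → suc k ≤ b × iter f (suc k) x ≡ x
  iter-period x zero    (suc b) _         x≡fᵇ⁺¹x = b , ≤-refl , sym x≡fᵇ⁺¹x
  iter-period x (suc a) (suc b) (s≤s a<b) fᵃ⁺¹x≡fᵇ⁺¹x with iter-period x a b a<b (f-injective fᵃ⁺¹x≡fᵇ⁺¹x)
  ... | k , k<b , fᵏ⁺¹x≡x = k , m≤n⇒m≤1+n k<b , fᵏ⁺¹x≡x

  iter-periodic : ∀ x → ∃ λ k → k < N × iter f (suc k) x ≡ x
  iter-periodic x with pigeonhole (n<1+n N) (λ (i : Fin (suc N)) → iter f (toℕ i) x)
  ... | i , j , i<j , fⁱx≡fʲx with iter-period x (toℕ i) (toℕ j) i<j fⁱx≡fʲx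
  ...   | k , k<j , fᵏ⁺¹x≡x = k , ≤-trans k<j (s≤s⁻¹ (toℕ<n j)) , fᵏ⁺¹x≡x

  injective⇒permutation : Permutation′ N
  injective⇒permutation = permutation f f⁻¹ f∘f⁻¹ (λ x → f-injective (f∘f⁻¹ (f x)))
    where
    f⁻¹ : Fin N → Fin N
    f⁻¹ x = iter f (proj₁ (iter-periodic x)) x

    f∘f⁻¹ : ∀ x → f (f⁻¹ x) ≡ x
    f∘f⁻¹ x = proj₂ (proj₂ (iter-periodic x))

  isMin⇒≤-iter : ∀ y → T (isMin f y) → ∀ k → k < N → toℕ y ≤ toℕ (iter f k y)
  isMin⇒≤-iter y min k k<N =
    ≤ᵇ⇒≤ _ _ (applyUpTo⁻ _ N (all⁺ (λ k → toℕ y ≤ᵇ toℕ (iter f k y)) (upTo N) min) k<N)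

  isMin-image⇒≤ : ∀ h → T (isMin f (f h)) → toℕ (f h) ≤ toℕ h
  isMin-image⇒≤ h min with iter-periodic h
  ... | k , k<N , fᵏ⁺¹h≡h =
    subst (λ z → toℕ (f h) ≤ toℕ z) (trans (iter-suc f k h) fᵏ⁺¹h≡h) (isMin⇒≤-iter (f h) min k k<N)

module _ {N : ℕ} {ι : Fin N → Fin N}
         (ι-involutive : ∀ x → ι (ι x) ≡ x) (ι-fixpointFree : ∀ x → ι x ≢ x) where

  count-descents-involution : count (λ x → toℕ (ι x) <ᵇ toℕ x) + count (λ x → toℕ (ι x) <ᵇ toℕ x) ≡ N
  count-descents-involution = begin
    count descent + count descent      ≡⟨ cong (_+_ (count descent)) ascents≡descents ⟨
    count descent + count ascent       ≡⟨ count-∨-disjoint descent ascent descent⇒¬ascent ⟨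
    count (λ x → descent x ∨ ascent x) ≡⟨ count-all descent-or-ascent ⟩
    N                                  ∎
    where
    open ≡-Reasoning

    descent ascent : Fin N → Bool
    descent x = toℕ (ι x) <ᵇ toℕ x
    ascent  x = toℕ x <ᵇ toℕ (ι x)

    ascents≡descents : count ascent ≡ count descent
    ascents≡descents =
      trans (count-cong (λ x → cong (λ y → toℕ y <ᵇ toℕ (ι x)) (sym (ι-involutive x))))
            (count-permute descent (permutation ι ι ι-involutive ι-involutive))

    descent⇒¬ascent : ∀ x → T (descent x) → ¬ T (ascent x)
    descent⇒¬ascent x d a = <-asym (<ᵇ⇒< (toℕ (ι x)) (toℕ x) d) (<ᵇ⇒< (toℕ x) (toℕ (ι x)) a)

    descent-or-ascent : ∀ x → T (descent x ∨ ascent x)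
    descent-or-ascent x with <-cmp (toℕ (ι x)) (toℕ x)
    ... | tri< ιx<x _ _ = Equivalence.from T-∨ (inj₁ (<⇒<ᵇ ιx<x))
    ... | tri≈ _ ιx≡x _ = ⊥-elim (ι-fixpointFree x (toℕ-injective ιx≡x))
    ... | tri> _ _ x<ιx = Equivalence.from T-∨ (inj₂ (<⇒<ᵇ x<ιx))

module _ {n : ℕ} (b : PlantedBicellular n) where
  open PlantedBicellular b

  p₄ : ℕ
  p₄ = 3 + 2 ℕ.* n

  α-injective : Injective _≡_ _≡_ α
  α-injective {x} {y} αx≡αy = trans (sym (α-invol x)) (trans (cong α αx≡αy) (α-invol y))

  γ⁻¹ : ℕ → ℕ
  γ⁻¹ zero    = suc m
  γ⁻¹ (suc t) = if does (t ≟ suc m) then p₄ else t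

  γ⁻¹-suc : ∀ t → t ≢ suc m → γ⁻¹ (suc t) ≡ t
  γ⁻¹-suc t t≢1+m = cong (if_then p₄ else t) (dec-false (t ≟ suc m) t≢1+m)

  p₃<N : 2 + m < 4 + 2 ℕ.* n
  p₃<N = s≤s (s≤s (s≤s (m≤n⇒m≤1+n m≤2n)))

  γ⁻¹-p₃ : γ⁻¹ (2 + m) ≡ p₄
  γ⁻¹-p₃ = cong (if_then p₄ else suc m) (dec-true (suc m ≟ suc m) refl)

  γ⁻¹-γ : ∀ h → γ⁻¹ (toℕ (γ′ h)) ≡ toℕ h
  γ⁻¹-γ h with toℕ h ≟ suc m
  ... | yes h≡p₂ = sym h≡p₂
  ... | no h≢p₂ with toℕ h ≟ p₄
  ...   | yes h≡p₄ = trans (cong γ⁻¹ (toℕ-fromℕ< p₃<N)) (trans γ⁻¹-p₃ (sym h≡p₄))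
  ...   | no h≢p₄ = trans (cong (γ⁻¹ ∘ suc) (toℕ-lower₁ h (h≢p₄ ∘ sym))) (γ⁻¹-suc (toℕ h) h≢p₂)

  γ-injective : Injective _≡_ _≡_ γ′
  γ-injective {x} {y} γx≡γy =
    toℕ-injective (trans (sym (γ⁻¹-γ x)) (trans (cong (γ⁻¹ ∘ toℕ) γx≡γy) (γ⁻¹-γ y)))

  σ-injective : Injective _≡_ _≡_ σ
  σ-injective = γ-injective ∘ α-injective

  plantRoot descent downStepTo : HE n → Bool
  plantRoot x  = (toℕ x ≡ᵇ 0) ∨ (toℕ x ≡ᵇ 2 + m)
  descent x    = toℕ (α x) <ᵇ toℕ x
  downStepTo x = toℕ (α x) ≤ᵇ γ⁻¹ (toℕ x)

  downStep≡downStepTo-γ : ∀ h → downStep h ≡ downStepTo (γ′ h)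
  downStep≡downStepTo-γ h = cong (toℕ (σ h) ≤ᵇ_) (sym (γ⁻¹-γ h))

  downStepTo-split : ∀ x → downStepTo x ≡ plantRoot x ∨ descent x
  downStepTo-split zero = both-true (≤⇒≤ᵇ (≤-reflexive plant₁)) _
  downStepTo-split (suc y) with toℕ y ≟ suc m
  ... | yes y≡p₂ = both-true (≤⇒≤ᵇ (≤-reflexive α-p₃)) (Equivalence.from T-∨ (inj₁ p₃-root))
    where
    α-p₃ : toℕ (α (suc y)) ≡ γ⁻¹ (suc (toℕ y))
    α-p₃ = trans (plant₂ (suc y) (cong suc y≡p₂)) (sym (trans (cong (γ⁻¹ ∘ suc) y≡p₂) γ⁻¹-p₃))

    p₃-root : T (plantRoot (suc y))
    p₃-root = Equivalence.from T-∨ (inj₂ (≡⇒≡ᵇ _ _ (cong suc y≡p₂)))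
  ... | no y≢p₂ rewrite γ⁻¹-suc (toℕ y) y≢p₂ | dec-false (toℕ y ≟ suc m) y≢p₂ =
    does-⇔ (mk⇔ s≤s s≤s⁻¹) (toℕ (α (suc y)) ≤? toℕ y) (toℕ (α (suc y)) <? suc (toℕ y))

  plantRoot⇒¬descent : ∀ x → T (plantRoot x) → ¬ T (descent x)
  plantRoot⇒¬descent zero    _    ()
  plantRoot⇒¬descent (suc y) root d with toℕ y ≟ suc m
  ... | yes y≡p₂ = <⇒≱ (subst₂ _<_ (plant₂ (suc y) (cong suc y≡p₂)) (cong suc y≡p₂) (<ᵇ⇒< _ _ d))
                       (s≤s (s≤s (m≤n⇒m≤1+n m≤2n)))
  ... | no y≢p₂ = y≢p₂ (≡ᵇ⇒≡ _ _ root)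

  count-plantRoot : count plantRoot ≡ 2
  count-plantRoot = begin
    count plantRoot      ≡⟨ count-∨-disjoint p₁ p₃ (λ { zero _ () ; (suc _) () _ }) ⟩
    count p₁ + count p₃  ≡⟨ cong₂ _+_ (count-singleton {N = 4 + 2 ℕ.* n} 0 (s≤s ℕ.z≤n))
                                      (count-singleton (2 + m) p₃<N) ⟩
    2                    ∎
    where
    open ≡-Reasoning

    p₁ p₃ : HE n → Bool
    p₁ x = toℕ x ≡ᵇ 0
    p₃ x = toℕ x ≡ᵇ 2 + m

  count-descent : count descent ≡ n + 2
  count-descent = *-cancelˡ-≡ _ _ 2 (begin
    2 ℕ.* count descent               ≡⟨ cong (_+_ (count descent)) (+-identityʳ (count descent)) ⟩
    count descent + count descent     ≡⟨ count-descents-involution α-invol α-fpf ⟩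
    4 + 2 ℕ.* n                       ≡⟨ +-comm 4 (2 ℕ.* n) ⟩
    2 ℕ.* n + 4                       ≡⟨ *-distribˡ-+ 2 n 2 ⟨
    2 ℕ.* (n + 2)                     ∎)
    where open ≡-Reasoning

  count-downStep : count downStep ≡ (n + 2) + 2
  count-downStep = begin
    count downStep                          ≡⟨ count-cong downStep≡downStepTo-γ ⟩
    count (downStepTo ∘ γ′)                 ≡⟨ count-permute downStepTo (injective⇒permutation γ-injective) ⟩
    count downStepTo                        ≡⟨ count-cong downStepTo-split ⟩
    count (λ x → plantRoot x ∨ descent x)   ≡⟨ count-∨-disjoint plantRoot descent plantRoot⇒¬descent ⟩
    count plantRoot + count descent         ≡⟨ cong₂ _+_ count-plantRoot count-descent ⟩
    2 + (n + 2)                             ≡⟨ +-comm 2 (n + 2) ⟩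
    (n + 2) + 2                             ∎
    where open ≡-Reasoning

  count-downStep-vertices : count downStep ≡ numVertices + numTrisections
  count-downStep-vertices = begin
    count downStep                          ≡⟨ count-⊆ downStep (isMin σ ∘ σ) minimum⇒downStep ⟩
    count (isMin σ ∘ σ) + count trisection  ≡⟨ cong (_+ count trisection) (count-permute (isMin σ) σ-permutation) ⟩
    count (isMin σ) + count trisection      ≡⟨ cong₂ _+_ (length-filterᵇ-tabulate (isMin σ) id)
                                                         (length-filterᵇ-tabulate trisection id) ⟨
    numVertices + numTrisections            ∎
    where
    open ≡-Reasoning

    σ-permutation : Permutation′ (4 + 2 ℕ.* n)
    σ-permutation = injective⇒permutation σ-injective

    minimum⇒downStep : ∀ h → T (isMin σ (σ h)) → T (downStep h)
    minimum⇒downStep h min = ≤⇒≤ᵇ (isMin-image⇒≤ σ-injective h min)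

  vertices+trisections : numVertices + numTrisections ≡ (n + 2) + 2
  vertices+trisections = trans (sym count-downStep-vertices) count-downStep

genus-arithmetic : ∀ v t k g → v ℤ.+ + 2 ≡ k ℤ.+ + 2 - + 2 * g → v ℤ.+ t ≡ k ℤ.+ + 2 →
                   t ≡ + 2 * (g ℤ.+ + 1)
genus-arithmetic v t k g genus v+t = begin
  t                                         ≡⟨ isolate v t ⟩
  (v ℤ.+ t) ℤ.+ + 2 - (v ℤ.+ + 2)           ≡⟨ cong₂ (λ s w → s ℤ.+ + 2 - w) v+t genus ⟩
  (k ℤ.+ + 2) ℤ.+ + 2 - (k ℤ.+ + 2 - + 2 * g) ≡⟨ simplify k g ⟩
  + 2 * (g ℤ.+ + 1)                         ∎
  where
  open ≡-Reasoning

  isolate : ∀ v t → t ≡ (v ℤ.+ t) ℤ.+ + 2 - (v ℤ.+ + 2)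
  isolate = solve-∀

  simplify : ∀ k g → (k ℤ.+ + 2) ℤ.+ + 2 - (k ℤ.+ + 2 - + 2 * g) ≡ + 2 * (g ℤ.+ + 1)
  simplify = solve-∀

lemma2 : (n : ℕ) (b : PlantedBicellular n) (g : ℤ)
    → + PlantedBicellular.numVertices b Data.Integer.+ + 2 ≡ + (n + 2) Data.Integer.+ + 2 - + 2 * g
    → + PlantedBicellular.numTrisections b ≡ + 2 * (g Data.Integer.+ + 1)
lemma2 n b g genus =
  genus-arithmetic (+ numVertices) (+ numTrisections) (+ (n + 2)) g genus vertices+trisections-ℤ
  where
  open PlantedBicellular b using (numVertices; numTrisections)

  vertices+trisections-ℤ : + numVertices ℤ.+ + numTrisections ≡ + (n + 2) ℤ.+ + 2
  vertices+trisections-ℤ = begin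
    + numVertices ℤ.+ + numTrisections  ≡⟨ pos-+ numVertices numTrisections ⟨
    + (numVertices + numTrisections)    ≡⟨ cong +_ (vertices+trisections b) ⟩
    + ((n + 2) + 2)                     ≡⟨ pos-+ (n + 2) 2 ⟩
    + (n + 2) ℤ.+ + 2                   ∎
    where open ≡-Reasoning
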